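{- Let $p$ and $q$ be odd primes and $e$ a positive integer. If $p^e+1=2^aq^b$ for some integers $a$ and $b$, then one of the following holds: (a) $e=1$; (b) $e$ is even and $q\equiv 1\pmod{2e}$; (c) $p$ is a Mersenne prime and $q\equiv 1\pmod{2e}$.
   Context: A Mersenne prime is a prime of the form $2^m-1$ for some positive integer $m$. -}

module Defs where

open import Data.Nat using (ℕ; _^_; _∸_; _≤_)
open import Data.Nat.Divisibility using (_∣_)
open import Data.Nat.Primality using (Prime)
open import Data.Product using (∃-syntax; _×_)
open import Relation.Binary.PropositionalEquality using (_≡_)

-- Congruence modulo m for natural numbers with y ≤ x : m ∣ (x - y).
-- Used only as  q ≡ 1 (mod m)  with q a prime (so q ≥ 1 and truncated
-- subtraction is exact).
_≡_[mod_] : ℕ → ℕ → ℕ → Set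
x ≡ y [mod m ] = y ≤ x × m ∣ (x ∸ y)

MersennePrime : ℕ → Set
MersennePrime p = Prime p × ∃[ m ] (1 ≤ m × p ≡ 2 ^ m ∸ 1)

-- Write e = d * r with r an odd prime and put x = p ^ d, so that x ^ r + 1 = (x + 1) * s with
-- s = ∑_{i<r} (-x) ^ i.  Since -x ≡ 1 modulo x + 1, s ≡ r modulo x + 1; hence s is odd, so it is a
-- power of q, and s > r.  If q ∣ x + 1 this forces q ∣ r, i.e. q = r, and then s ≡ r modulo q²
-- (lifting the exponent), so s = q = r: a contradiction.  Thus q ∤ p ^ d + 1 for every such d
-- (with q = 2 this also rules out p ^ e + 1 = 2 ^ a for odd e, while for even e, p ^ e + 1 ≡ 2
-- modulo 4).  So p ^ (2e) ≡ 1 but p ^ (2e / r) ≢ 1 modulo q for every prime r ∣ 2e, and Fermat's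
-- little theorem gives 2e ∣ q - 1.  If e is odd, p + 1 ∣ p ^ e + 1 while q ∤ p + 1, so p + 1 is a
-- power of 2.

module Submission where

module ElementaryFacts where
  open import Data.Nat
  open import Data.Nat.Properties
  open import Data.Nat.Divisibility
  open import Data.Nat.Primality
  open import Data.Nat.Primality.Factorisation using (factorise)
  open import Data.Nat.ListAction using (product)
  open import Data.Nat.Coprimality using (Coprime; coprime-divisor)
  open import Data.Nat.Combinatorics using (_C_; nCk≡n!/k![n-k]!; k![n∸k]!∣n!)
  open import Data.Nat.DivMod using (m/n*n≡m)
  open import Data.Nat.Tactic.RingSolver using (solve-∀)
  open import Data.List.Base using ([]; _∷_)
  open import Data.List.Relation.Unary.All using (_∷_)
  open import Data.Product using (∃-syntax; _×_; _,_)
  open import Data.Sum using (inj₁; inj₂)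
  open import Data.Empty using (⊥-elim)
  open import Function using (_∘_)
  open import Relation.Nullary using (¬_; yes; no)
  open import Relation.Binary.PropositionalEquality

  odd⇒≡1+j*2 : ∀ n → ¬ 2 ∣ n → ∃[ j ] n ≡ suc (j * 2)
  odd⇒≡1+j*2 zero n-odd = ⊥-elim (n-odd (2 ∣0))
  odd⇒≡1+j*2 (suc zero) _ = 0 , refl
  odd⇒≡1+j*2 (suc (suc n)) 2+n-odd with odd⇒≡1+j*2 n (2+n-odd ∘ ∣m∣n⇒∣m+n (∣-refl {2}))
  ... | j , refl = suc j , refl

  odd⇒2∣n+1 : ∀ {n} → ¬ 2 ∣ n → 2 ∣ n + 1
  odd⇒2∣n+1 {n} n-odd with odd⇒≡1+j*2 n n-odd
  ... | j , refl = divides (suc j) (+-comm (suc (j * 2)) 1)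

  odd-^ : ∀ {x} n → ¬ 2 ∣ x → ¬ 2 ∣ x ^ n
  odd-^ zero _ 2∣1 with ∣1⇒≡1 2∣1
  ... | ()
  odd-^ (suc n) x-odd 2∣x^[1+n] with euclidsLemma _ _ prime[2] 2∣x^[1+n]
  ... | inj₁ 2∣x = x-odd 2∣x
  ... | inj₂ 2∣x^n = odd-^ n x-odd 2∣x^n

  odd-prime⇒3≤ : ∀ {p} → Prime p → ¬ 2 ∣ p → 3 ≤ p
  odd-prime⇒3≤ {2} _ p-odd = ⊥-elim (p-odd ∣-refl)
  odd-prime⇒3≤ {suc (suc (suc _))} _ _ = s≤s (s≤s (s≤s z≤n))

  prime⇒1< : ∀ {p} → Prime p → 1 < p
  prime⇒1< {p} pp = nonTrivial⇒n>1 p {{prime⇒nonTrivial pp}}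

  prime⇒1≤ : ∀ {p} → Prime p → 1 ≤ p
  prime⇒1≤ pp = <⇒≤ (prime⇒1< pp)

  prime∣prime⇒≡ : ∀ {p q} → Prime p → Prime q → p ∣ q → p ≡ q
  prime∣prime⇒≡ pp pq p∣q with prime⇒irreducible pq p∣q
  ... | inj₁ refl = ⊥-elim (¬prime[1] pp)
  ... | inj₂ p≡q = p≡q

  m∣m^n : ∀ {m n} → 1 ≤ n → m ∣ m ^ n
  m∣m^n {m} {suc n} _ = m∣m*n (m ^ n)

  prime∤⇒coprime : ∀ {p d} → Prime p → ¬ p ∣ d → Coprime d p
  prime∤⇒coprime pp p∤d (i∣d , i∣p) with prime⇒irreducible pp i∣p
  ... | inj₁ i≡1 = i≡1
  ... | inj₂ refl = ⊥-elim (p∤d i∣d)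

  coprime-∣^* : ∀ {d p m} n → Coprime d p → d ∣ p ^ n * m → d ∣ m
  coprime-∣^* {m = m} zero _ d∣1*m = subst (_ ∣_) (+-identityʳ m) d∣1*m
  coprime-∣^* {d} {p} {m} (suc n) d⊥p d∣p^[1+n]*m =
    coprime-∣^* n d⊥p (coprime-divisor d⊥p (subst (d ∣_) (*-assoc p (p ^ n) m) d∣p^[1+n]*m))

  ∣p^n⇒≡p^m : ∀ {p d} n → Prime p → d ∣ p ^ n → ∃[ m ] d ≡ p ^ m
  ∣p^n⇒≡p^m zero _ d∣1 = 0 , ∣1⇒≡1 d∣1
  ∣p^n⇒≡p^m {p} {d} (suc n) pp d∣p^[1+n] with p ∣? d
  ... | no p∤d = ∣p^n⇒≡p^m n pp (coprime-divisor (prime∤⇒coprime pp p∤d) d∣p^[1+n])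
  ... | yes (divides d′ refl)
    with ∣p^n⇒≡p^m {d = d′} n pp
           (*-cancelʳ-∣ p {{prime⇒nonZero pp}} (subst (d′ * p ∣_) (*-comm p (p ^ n)) d∣p^[1+n]))
  ...   | m , refl = suc m , *-comm (p ^ m) p

  ∃prime∣ : ∀ {n} → 2 ≤ n → ∃[ r ] Prime r × r ∣ n
  ∃prime∣ {n@(suc _)} 2≤n with factorise n
  ... | record { factors = r ∷ rs ; isFactorisation = eq ; factorsPrime = pr ∷ _ } =
    r , pr , subst (r ∣_) (sym eq) (m∣m*n (product rs))
  ... | record { factors = [] ; isFactorisation = eq } = ⊥-elim (<-irrefl (sym eq) 2≤n)

  odd⇒∃oddPrime-factor : ∀ {n} → 2 ≤ n → ¬ 2 ∣ n → ∃[ d ] ∃[ r ] Prime r × ¬ 2 ∣ r × n ≡ d * r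
  odd⇒∃oddPrime-factor 2≤n n-odd with ∃prime∣ 2≤n
  ... | r , pr , r∣n@(divides d n≡d*r) = d , r , pr , (λ 2∣r → n-odd (∣-trans 2∣r r∣n)) , n≡d*r

  ∣-maximal⇒≡ : ∀ {g n} .{{_ : NonZero n}} → g ∣ n →
                (∀ {r m} → Prime r → n ≡ r * m → ¬ g ∣ m) → g ≡ n
  ∣-maximal⇒≡ {g} {n} (divides zero n≡0*g) _ = ⊥-elim (≢-nonZero⁻¹ n n≡0*g)
  ∣-maximal⇒≡ {g} {n} (divides 1 n≡1*g) _ = sym (trans n≡1*g (*-identityˡ g))
  ∣-maximal⇒≡ {g} {n} (divides c@(suc (suc _)) n≡c*g) maximal with ∃prime∣ {c} (s≤s (s≤s z≤n))
  ... | r , pr , divides c′ c≡c′*r = ⊥-elim (maximal pr n≡r*c′g (n∣m*n c′))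
    where n≡r*c′g : n ≡ r * (c′ * g)
          n≡r*c′g = trans n≡c*g (trans (cong (_* g) (trans c≡c′*r (*-comm c′ r))) (*-assoc r c′ g))

  prime∤! : ∀ {p n} → Prime p → n < p → ¬ p ∣ n !
  prime∤! {n = zero} pp _ p∣1 = ¬prime[1] (subst Prime (∣1⇒≡1 p∣1) pp)
  prime∤! {n = suc n} pp n<p p∣n! with euclidsLemma (suc n) (n !) pp p∣n!
  ... | inj₁ p∣1+n = <⇒≱ n<p (∣⇒≤ p∣1+n)
  ... | inj₂ p∣n! = prime∤! pp (<-trans (n<1+n n) n<p) p∣n!

  prime∣pCk : ∀ {p k} → Prime p → 0 < k → k < p → p ∣ p C k
  prime∣pCk {p@(suc p′)} {k} pp 0<k k<p
    with euclidsLemma (p C k) (k ! * (p ∸ k) !) pp (subst (p ∣_) (sym pCk*k![p∸k]!≡p!) (m∣m*n (p′ !)))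
    where
    instance _ = k !* (p ∸ k) !≢0
    pCk*k![p∸k]!≡p! : (p C k) * (k ! * (p ∸ k) !) ≡ p !
    pCk*k![p∸k]!≡p! = trans (cong (_* (k ! * (p ∸ k) !)) (nCk≡n!/k![n-k]! (<⇒≤ k<p)))
                             (m/n*n≡m (k![n∸k]!∣n! (<⇒≤ k<p)))
  ... | inj₁ p∣pCk = p∣pCk
  ... | inj₂ p∣k![p∸k]! with euclidsLemma (k !) ((p ∸ k) !) pp p∣k![p∸k]!
  ...   | inj₁ p∣k! = ⊥-elim (prime∤! pp k<p p∣k!)
  ...   | inj₂ p∣[p∸k]! = ⊥-elim (prime∤! pp (∸-monoʳ-< 0<k (<⇒≤ k<p)) p∣[p∸k]!)

  x≤x^n : ∀ {x n} → 1 ≤ x → 1 ≤ n → x ≤ x ^ n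
  x≤x^n {x} {n} 1≤x 1≤n = subst (_≤ x ^ n) (*-identityʳ x) (^-monoʳ-≤ x {{>-nonZero 1≤x}} 1≤n)

  [x+1]*[2+k]≤x^[2+k] : ∀ {x} k → 3 ≤ x → (x + 1) * (2 + k) ≤ x ^ (2 + k)
  [x+1]*[2+k]≤x^[2+k] {x} zero (s≤s (s≤s (s≤s {n = u} _))) =
    subst ((x + 1) * 2 ≤_) (sym (e u)) (m≤m+n _ _)
    where e : ∀ u → (3 + u) * ((3 + u) * 1) ≡ (3 + u + 1) * 2 + (1 + 4 * u + u * u)
          e = solve-∀
  [x+1]*[2+k]≤x^[2+k] {x} (suc k) 3≤x@(s≤s (s≤s (s≤s {n = u} _))) = begin
    (x + 1) * (3 + k)       ≤⟨ subst ((x + 1) * (3 + k) ≤_) (sym (e u k)) (m≤m+n _ _) ⟩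
    x * ((x + 1) * (2 + k)) ≤⟨ *-monoʳ-≤ x ([x+1]*[2+k]≤x^[2+k] k 3≤x) ⟩
    x * x ^ (2 + k)         ∎
    where open ≤-Reasoning
          e : ∀ u k → (3 + u) * ((3 + u + 1) * (2 + k)) ≡
                      (3 + u + 1) * (3 + k) + (4 + u) * (3 + 2 * k + 2 * u + u * k)
          e = solve-∀

  2<x^2+1 : ∀ {x} → 3 ≤ x → 2 < x ^ 2 + 1
  2<x^2+1 3≤x =
    ≤-trans 3≤x (≤-trans (x≤x^n {n = 2} (≤-trans (s≤s z≤n) 3≤x) (s≤s z≤n)) (m≤m+n _ 1))

  odd^2+1≢2^a : ∀ {x} a → 3 ≤ x → ¬ 2 ∣ x → x ^ 2 + 1 ≢ 2 ^ a
  odd^2+1≢2^a {x} (suc (suc a)) _ x-odd x^2+1≡2^[2+a] with odd⇒≡1+j*2 x x-odd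
  ... | j , refl =
    4∤2 (∣m+n∣m⇒∣n (subst (4 ∣_) (trans (sym x^2+1≡2^[2+a]) (e j)) 4∣2^[2+a]) (n∣m*n (j * j + j)))
    where e : ∀ j → (1 + j * 2) * ((1 + j * 2) * 1) + 1 ≡ (j * j + j) * 4 + 2
          e = solve-∀
          4∣2^[2+a] : 4 ∣ 2 ^ (2 + a)
          4∣2^[2+a] = divides (2 ^ a) (trans (sym (*-assoc 2 2 (2 ^ a))) (*-comm 4 (2 ^ a)))
          4∤2 : ¬ 4 ∣ 2
          4∤2 4∣2 with ∣⇒≤ 4∣2
          ... | s≤s (s≤s ())
  odd^2+1≢2^a 0 3≤x _ x^2+1≡1 = <⇒≢ (<-trans (n<1+n 1) (2<x^2+1 3≤x)) (sym x^2+1≡1)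
  odd^2+1≢2^a 1 3≤x _ x^2+1≡2 = <⇒≢ (2<x^2+1 3≤x) (sym x^2+1≡2)

  triangle : ℕ → ℕ
  triangle zero = 0
  triangle (suc n) = triangle n + n

  triangle[1+j*2] : ∀ j → triangle (suc (j * 2)) ≡ j * suc (j * 2)
  triangle[1+j*2] zero = refl
  triangle[1+j*2] (suc j) rewrite triangle[1+j*2] j = e j
    where e : ∀ j → j * suc (j * 2) + suc (j * 2) + suc (suc (j * 2)) ≡ suc j * suc (suc (suc (j * 2)))
          e = solve-∀

module Congruences where
  import Data.Nat as ℕ
  open ℕ using (ℕ; zero; suc; _∸_)
  import Data.Nat.Properties as ℕ
  import Data.Nat.Divisibility as ℕ
  open import Data.Nat.Primality using (Prime; euclidsLemma; prime⇒nonZero)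
  open import Data.Nat.GCD using (gcd; gcd-GCD; module Bézout)
  open import Data.Nat.Combinatorics using (_C_; nCn≡1)
  open import Data.Fin.Base using (zero; suc; toℕ; inject₁)
  open import Data.Fin.Properties using (toℕ-inject₁; toℕ<n; toℕ-fromℕ)
  open import Data.Vec.Functional using (Vector; init; last; tail)
  import Data.Integer as ℤ
  open ℤ using (ℤ; +_; -_; 0ℤ; 1ℤ; _+_; _-_; _*_; _^_)
  open import Data.Integer.Properties
  open import Data.Integer.Divisibility.Signed
  open import Data.Integer.Tactic.RingSolver using (solve-∀)
  open import Algebra.Properties.Semiring.Sum +-*-semiring using (sum; sum-init-last)
  open import Algebra.Properties.Semiring.Mult +-*-semiring using (_×_)
  import Algebra.Properties.CommutativeSemiring.Binomial +-*-commutativeSemiring as Binomial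
  import Algebra.Properties.Semiring.Exp +-*-semiring as Semiring
  open import Data.Product using (_,_)
  open import Data.Sum using (_⊎_; inj₁; inj₂)
  open import Data.Empty using (⊥-elim)
  open import Relation.Nullary using (¬_)
  open import Relation.Binary.PropositionalEquality
  open ElementaryFacts using (prime∣pCk; odd⇒≡1+j*2; prime⇒1<; triangle; triangle[1+j*2])

  pos-^ : ∀ m n → + (m ℕ.^ n) ≡ (+ m) ^ n
  pos-^ m zero = refl
  pos-^ m (suc n) = trans (pos-* m (m ℕ.^ n)) (cong ((+ m) *_) (pos-^ m n))

  ×≡* : ∀ n z → n × z ≡ + n * z
  ×≡* zero z = sym (*-zeroˡ z)
  ×≡* (suc n) z = trans (cong (λ w → z + w) (×≡* n z)) (e (+ n) z)
    where e : ∀ n z → z + n * z ≡ (1ℤ + n) * z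
          e = solve-∀

  semiring-^≡^ : ∀ x n → x Semiring.^ n ≡ x ^ n
  semiring-^≡^ x zero = refl
  semiring-^≡^ x (suc n) = cong (x *_) (semiring-^≡^ x n)

  ∣-sum : ∀ {d n} (f : Vector ℤ n) → (∀ i → d ∣ f i) → d ∣ sum f
  ∣-sum {n = zero} f _ = divides 0ℤ refl
  ∣-sum {n = suc n} f d∣f = ∣m∣n⇒∣m+n (d∣f zero) (∣-sum (tail f) (λ i → d∣f (suc i)))

  freshman's-dream : ∀ {q} → Prime q → ∀ x y → + q ∣ (x + y) ^ q - (x ^ q + y ^ q)
  freshman's-dream {q@(suc m)} pq x y = subst (+ q ∣_) (sym expansion) (∣-sum middle q∣middle)
    where
    t : Vector ℤ (suc q)
    t = Binomial.binomialTerm x y q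
    middle : Vector ℤ m
    middle = init (tail t)

    term : ℕ → ℤ
    term j = (q C j) × (x Semiring.^ j * y Semiring.^ (q ∸ j))

    first : t zero ≡ y ^ q
    first = trans (×≡* 1 _) (trans (*-identityˡ _) (trans (*-identityˡ _) (semiring-^≡^ y q)))

    final : last (tail t) ≡ x ^ q
    final = begin
      last (tail t)
        ≡⟨ cong term (cong suc (toℕ-fromℕ m)) ⟩
      term q
        ≡⟨ cong₂ (λ c j → c × (x Semiring.^ q * y Semiring.^ j)) (nCn≡1 q) (ℕ.n∸n≡0 q) ⟩
      1 × (x Semiring.^ q * 1ℤ)
        ≡⟨ trans (×≡* 1 _) (trans (*-identityˡ _) (*-identityʳ _)) ⟩
      x Semiring.^ q
        ≡⟨ semiring-^≡^ x q ⟩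
      x ^ q
        ∎
      where open ≡-Reasoning

    q∣middle : ∀ i → + q ∣ middle i
    q∣middle i = subst (+ q ∣_) (sym (×≡* (q C k) _))
      (∣m⇒∣m*n _ (∣ᵤ⇒∣ {+ q} {+ (q C k)} (prime∣pCk pq (ℕ.s≤s ℕ.z≤n) k<q)))
      where k = suc (toℕ (inject₁ i))
            k<q : k ℕ.< q
            k<q = ℕ.s≤s (subst (ℕ._< m) (sym (toℕ-inject₁ i)) (toℕ<n i))

    expansion : (x + y) ^ q - (x ^ q + y ^ q) ≡ sum middle
    expansion = begin
      (x + y) ^ q - S
        ≡⟨ cong (_- S) (sym (semiring-^≡^ (x + y) q)) ⟩
      (x + y) Semiring.^ q - S
        ≡⟨ cong (_- S) (Binomial.theorem q x y) ⟩
      t zero + sum (tail t) - S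
        ≡⟨ cong (λ s → t zero + s - S) (sum-init-last (tail t)) ⟩
      t zero + (sum middle + last (tail t)) - S
        ≡⟨ cong₂ (λ a b → a + (sum middle + b) - S) first final ⟩
      y ^ q + (sum middle + x ^ q) - (x ^ q + y ^ q)
        ≡⟨ e (y ^ q) (sum middle) (x ^ q) ⟩
      sum middle
        ∎
      where open ≡-Reasoning
            S = x ^ q + y ^ q
            e : ∀ a b c → a + (b + c) - (c + a) ≡ b
            e = solve-∀

  fermat : ∀ {q} → Prime q → ∀ a → + q ∣ (+ a) ^ q - + a
  fermat {suc _} _ zero = divides 0ℤ refl
  fermat {q} pq (suc a) = subst (+ q ∣_) split (∣m∣n⇒∣m+n (freshman's-dream pq 1ℤ (+ a)) (fermat pq a))
    where
    split : ((1ℤ + + a) ^ q - (1ℤ ^ q + (+ a) ^ q)) + ((+ a) ^ q - + a) ≡ (1ℤ + + a) ^ q - (1ℤ + + a)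
    split rewrite ^-zeroˡ q = e (+ a) ((+ a) ^ q) ((1ℤ + + a) ^ q)
      where e : ∀ u v w → (w - (1ℤ + v)) + (v - u) ≡ w - (1ℤ + u)
            e = solve-∀

  euclidsLemmaℤ : ∀ {p} i j → Prime p → (+ p) ∣ i * j → (+ p) ∣ i ⊎ (+ p) ∣ j
  euclidsLemmaℤ i j pp p∣ij
    with euclidsLemma ℤ.∣ i ∣ ℤ.∣ j ∣ pp (subst (_ ℕ.∣_) (abs-* i j) (∣⇒∣ᵤ p∣ij))
  ... | inj₁ p∣i = inj₁ (∣ᵤ⇒∣ p∣i)
  ... | inj₂ p∣j = inj₂ (∣ᵤ⇒∣ p∣j)

  infix 4 _^_≡1[mod_]
  _^_≡1[mod_] : ℕ → ℕ → ℕ → Set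
  x ^ n ≡1[mod m ] = (+ m) ∣ (+ x) ^ n - 1ℤ

  module _ {m x : ℕ} where

    private
      X = + x
      ^[a+b]-1 : ∀ a b → X ^ (a ℕ.+ b) - 1ℤ ≡ X ^ a * (X ^ b - 1ℤ) + (X ^ a - 1ℤ)
      ^[a+b]-1 a b rewrite ^-distribˡ-+-* X a b = e (X ^ a) (X ^ b)
        where e : ∀ u v → u * v - 1ℤ ≡ u * (v - 1ℤ) + (u - 1ℤ)
              e = solve-∀

    ^≡1-+ : ∀ {a b} → x ^ a ≡1[mod m ] → x ^ b ≡1[mod m ] → x ^ (a ℕ.+ b) ≡1[mod m ]
    ^≡1-+ {a} {b} ha hb = subst ((+ m) ∣_) (sym (^[a+b]-1 a b)) (∣m∣n⇒∣m+n (∣n⇒∣m*n (X ^ a) hb) ha)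

    ^≡1-∸ : ∀ {a b} → x ^ (a ℕ.+ b) ≡1[mod m ] → x ^ b ≡1[mod m ] → x ^ a ≡1[mod m ]
    ^≡1-∸ {a} {b} hab hb = ∣m+n∣m⇒∣n (subst ((+ m) ∣_) (^[a+b]-1 a b) hab) (∣n⇒∣m*n (X ^ a) hb)

    ^≡1-* : ∀ {n} k → x ^ n ≡1[mod m ] → x ^ (k ℕ.* n) ≡1[mod m ]
    ^≡1-* zero _ = divides 0ℤ refl
    ^≡1-* {n} (suc k) hn = ^≡1-+ {n} {k ℕ.* n} hn (^≡1-* k hn)

    ^≡1-gcd : ∀ {a b} → x ^ a ≡1[mod m ] → x ^ b ≡1[mod m ] → x ^ gcd a b ≡1[mod m ]
    ^≡1-gcd {a} {b} ha hb with Bézout.identity (gcd-GCD a b)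
    ... | Bézout.+- u v eq =
      ^≡1-∸ {gcd a b} {v ℕ.* b} (subst (x ^_≡1[mod m ]) (sym eq) (^≡1-* {a} u ha)) (^≡1-* {b} v hb)
    ... | Bézout.-+ u v eq =
      ^≡1-∸ {gcd a b} {u ℕ.* a} (subst (x ^_≡1[mod m ]) (sym eq) (^≡1-* {b} v hb)) (^≡1-* {a} u ha)

  pos-^+1 : ∀ x n → + (x ℕ.^ n ℕ.+ 1) ≡ (+ x) ^ n + 1ℤ
  pos-^+1 x n = trans (pos-+ (x ℕ.^ n) 1) (cong (_+ 1ℤ) (pos-^ x n))

  fermat-^≡1 : ∀ {q x} → Prime q → ¬ q ℕ.∣ x → x ^ (q ∸ 1) ≡1[mod q ]
  fermat-^≡1 {q@(suc n)} {x} pq q∤x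
    with euclidsLemmaℤ (+ x) ((+ x) ^ n - 1ℤ) pq (subst ((+ q) ∣_) (e (+ x) ((+ x) ^ n)) (fermat pq x))
    where e : ∀ u v → u * v - u ≡ u * (v - 1ℤ)
          e = solve-∀
  ... | inj₁ q∣x = ⊥-elim (q∤x (∣⇒∣ᵤ q∣x))
  ... | inj₂ q∣x^n-1 = q∣x^n-1

  module _ {m x n : ℕ} where

    private
      Y = (+ x) ^ n
      ^[2*n]-1 : (+ x) ^ (2 ℕ.* n) - 1ℤ ≡ (Y - 1ℤ) * (Y + 1ℤ)
      ^[2*n]-1 rewrite ℕ.+-identityʳ n | ^-distribˡ-+-* (+ x) n n = e Y
        where e : ∀ y → y * y - 1ℤ ≡ (y - 1ℤ) * (y + 1ℤ)
              e = solve-∀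

    ∣^+1⇒^[2*]≡1 : m ℕ.∣ x ℕ.^ n ℕ.+ 1 → x ^ (2 ℕ.* n) ≡1[mod m ]
    ∣^+1⇒^[2*]≡1 m∣ = subst ((+ m) ∣_) (sym ^[2*n]-1)
      (∣n⇒∣m*n (Y - 1ℤ) (subst ((+ m) ∣_) (pos-^+1 x n) (∣ᵤ⇒∣ m∣)))

    ^[2*]≡1⇒^≡1⊎∣^+1 : Prime m → x ^ (2 ℕ.* n) ≡1[mod m ] →
                       x ^ n ≡1[mod m ] ⊎ m ℕ.∣ x ℕ.^ n ℕ.+ 1
    ^[2*]≡1⇒^≡1⊎∣^+1 pm h with euclidsLemmaℤ (Y - 1ℤ) (Y + 1ℤ) pm (subst ((+ m) ∣_) ^[2*n]-1 h)
    ... | inj₁ m∣Y-1 = inj₁ m∣Y-1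
    ... | inj₂ m∣Y+1 = inj₂ (∣⇒∣ᵤ (subst ((+ m) ∣_) (sym (pos-^+1 x n)) m∣Y+1))

    ^≡1∧∣^+1⇒∣2 : x ^ n ≡1[mod m ] → m ℕ.∣ x ℕ.^ n ℕ.+ 1 → m ℕ.∣ 2
    ^≡1∧∣^+1⇒∣2 h m∣ =
      ∣⇒∣ᵤ (subst ((+ m) ∣_) (e Y) (∣m∣n⇒∣m-n (subst ((+ m) ∣_) (pos-^+1 x n) (∣ᵤ⇒∣ m∣)) h))
      where e : ∀ y → (y + 1ℤ) - (y - 1ℤ) ≡ + 2
            e = solve-∀

  geometricSum : ℤ → ℕ → ℤ
  geometricSum y zero = 0ℤ
  geometricSum y (suc n) = geometricSum y n + y ^ n

  [1-y]*geometricSum : ∀ y n → (1ℤ - y) * geometricSum y n ≡ 1ℤ - y ^ n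
  [1-y]*geometricSum y zero = e y
    where e : ∀ y → (1ℤ - y) * 0ℤ ≡ 1ℤ - 1ℤ
          e = solve-∀
  [1-y]*geometricSum y (suc n) = begin
    (1ℤ - y) * (geometricSum y n + y ^ n)         ≡⟨ *-distribˡ-+ (1ℤ - y) (geometricSum y n) (y ^ n) ⟩
    (1ℤ - y) * geometricSum y n + (1ℤ - y) * y ^ n ≡⟨ cong (_+ (1ℤ - y) * y ^ n) ([1-y]*geometricSum y n) ⟩
    1ℤ - y ^ n + (1ℤ - y) * y ^ n                 ≡⟨ e y (y ^ n) ⟩
    1ℤ - y * y ^ n                                ∎
    where open ≡-Reasoning
          e : ∀ y u → 1ℤ - u + (1ℤ - y) * u ≡ 1ℤ - y * u
          e = solve-∀

  d²∣[1+d]^i-[1+i*d] : ∀ d i → d * d ∣ (1ℤ + d) ^ i - (1ℤ + + i * d)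
  d²∣[1+d]^i-[1+i*d] d zero = divides 0ℤ (e d)
    where e : ∀ d → 1ℤ - (1ℤ + 0ℤ * d) ≡ 0ℤ * (d * d)
          e = solve-∀
  d²∣[1+d]^i-[1+i*d] d (suc i) = subst (d * d ∣_) (e d (+ i) ((1ℤ + d) ^ i))
    (∣m∣n⇒∣m+n (∣n⇒∣m*n (1ℤ + d) (d²∣[1+d]^i-[1+i*d] d i)) (∣n⇒∣m*n (+ i) ∣-refl))
    where e : ∀ d i u → (1ℤ + d) * (u - (1ℤ + i * d)) + i * (d * d) ≡ (1ℤ + d) * u - (1ℤ + (1ℤ + i) * d)
          e = solve-∀

  d²∣geometricSum[1+d]-[n+triangle*d] : ∀ d n → d * d ∣ geometricSum (1ℤ + d) n - (+ n + + triangle n * d)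
  d²∣geometricSum[1+d]-[n+triangle*d] d zero = divides 0ℤ (e d)
    where e : ∀ d → 0ℤ - (0ℤ + 0ℤ * d) ≡ 0ℤ * (d * d)
          e = solve-∀
  d²∣geometricSum[1+d]-[n+triangle*d] d (suc n) =
    subst (d * d ∣_) (e d (+ n) (+ triangle n) (geometricSum (1ℤ + d) n) ((1ℤ + d) ^ n))
    (∣m∣n⇒∣m+n (d²∣geometricSum[1+d]-[n+triangle*d] d n) (d²∣[1+d]^i-[1+i*d] d n))
    where e : ∀ d n t g u → (g - (n + t * d)) + (u - (1ℤ + n * d)) ≡ (g + u) - ((1ℤ + n) + (t + n) * d)
          e = solve-∀

  d∣geometricSum[1+d]-n : ∀ d n → d ∣ geometricSum (1ℤ + d) n - + n
  d∣geometricSum[1+d]-n d n = subst (d ∣_) (e (geometricSum (1ℤ + d) n) (+ n) (+ triangle n) d)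
    (∣m∣n⇒∣m+n (∣-trans (∣m⇒∣m*n d ∣-refl) (d²∣geometricSum[1+d]-[n+triangle*d] d n))
                (∣n⇒∣m*n (+ triangle n) ∣-refl))
    where e : ∀ g n t d → (g - (n + t * d)) + t * d ≡ g - n
          e = solve-∀

  [-x]^[1+j*2] : ∀ x j → (- x) ^ suc (j ℕ.* 2) ≡ - (x ^ suc (j ℕ.* 2))
  [-x]^[1+j*2] x zero = e x
    where e : ∀ x → (- x) * 1ℤ ≡ - (x * 1ℤ)
          e = solve-∀
  [-x]^[1+j*2] x (suc j) = trans (cong (λ u → (- x) * ((- x) * u)) ([-x]^[1+j*2] x j)) (e x (x ^ suc (j ℕ.* 2)))
    where e : ∀ x u → (- x) * ((- x) * (- u)) ≡ - (x * (x * u))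
          e = solve-∀

  cofactor : ℕ → ℕ → ℕ
  cofactor x n = ℤ.∣ geometricSum (- + x) n ∣

  [x+1]*cofactor : ∀ x {n} → ¬ 2 ℕ.∣ n → (x ℕ.+ 1) ℕ.* cofactor x n ≡ x ℕ.^ n ℕ.+ 1
  [x+1]*cofactor x {n} n-odd with odd⇒≡1+j*2 n n-odd
  ... | j , refl = trans (sym (abs-* (+ (x ℕ.+ 1)) G)) (cong ℤ.∣_∣ (begin
    + (x ℕ.+ 1) * G        ≡⟨ cong (_* G) (e₁ (+ x)) ⟩
    (1ℤ - - + x) * G       ≡⟨ [1-y]*geometricSum (- + x) n ⟩
    1ℤ - (- + x) ^ n       ≡⟨ cong (λ u → 1ℤ - u) ([-x]^[1+j*2] (+ x) j) ⟩
    1ℤ - - ((+ x) ^ n)     ≡⟨ e₂ ((+ x) ^ n) ⟩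
    (+ x) ^ n + 1ℤ         ≡⟨ sym (pos-^+1 x n) ⟩
    + (x ℕ.^ n ℕ.+ 1)      ∎))
    where open ≡-Reasoning
          G = geometricSum (- + x) n
          e₁ : ∀ x → x + 1ℤ ≡ 1ℤ - - x
          e₁ = solve-∀
          e₂ : ∀ u → 1ℤ - - u ≡ u + 1ℤ
          e₂ = solve-∀

  module _ {x : ℕ} where
    private
      G : ℕ → ℤ
      G = geometricSum (- + x)

      d : ℤ
      d = - + (x ℕ.+ 1)

      G≡geometricSum[1+d] : ∀ n → G n ≡ geometricSum (1ℤ + d) n
      G≡geometricSum[1+d] n = cong (λ y → geometricSum y n) (e (+ x))
        where e : ∀ x → - x ≡ 1ℤ + - (x + 1ℤ)
              e = solve-∀

      ∣x+1⇒∣d : ∀ {m} → m ℕ.∣ x ℕ.+ 1 → (+ m) ∣ d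
      ∣x+1⇒∣d m∣ = ∣m⇒∣-m (∣ᵤ⇒∣ m∣)

    ∣x+1∧∣cofactor⇒∣n : ∀ {m n} → m ℕ.∣ x ℕ.+ 1 → m ℕ.∣ cofactor x n → m ℕ.∣ n
    ∣x+1∧∣cofactor⇒∣n {m} {n} m∣x+1 m∣cofactor = ∣⇒∣ᵤ (subst ((+ m) ∣_) (e (G n) (+ n))
      (∣m∣n⇒∣m-n (∣ᵤ⇒∣ {+ m} {G n} m∣cofactor) (∣-trans (∣x+1⇒∣d m∣x+1) d∣Gn-n)))
      where e : ∀ g n → g - (g - n) ≡ n
            e = solve-∀
            d∣Gn-n : d ∣ G n - + n
            d∣Gn-n = subst (λ g → d ∣ g - + n) (sym (G≡geometricSum[1+d] n)) (d∣geometricSum[1+d]-n d n)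

    -- As q ∣ d, modulo q² we have G q ≡ q + triangle q * d ≡ q, since q ∣ triangle q for odd q.
    q²∤cofactor : ∀ {q} → Prime q → ¬ 2 ℕ.∣ q → q ℕ.∣ x ℕ.+ 1 → ¬ q ℕ.* q ℕ.∣ cofactor x q
    q²∤cofactor {q} pq q-odd q∣x+1 q²∣cofactor with odd⇒≡1+j*2 q q-odd | ∣x+1⇒∣d q∣x+1
    ... | j , refl | divides k d≡k*Q = ℕ.<⇒≱ q<q*q (ℕ.∣⇒≤ ⦃ prime⇒nonZero pq ⦄ (∣⇒∣ᵤ QQ∣Q))
      where
      Q = + q
      T = + triangle q

      T*d≡[j*k]*QQ : T * d ≡ (+ j * k) * (Q * Q)
      T*d≡[j*k]*QQ = begin
        T * d                   ≡⟨ cong₂ _*_ (cong +_ (triangle[1+j*2] j)) d≡k*Q ⟩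
        + (j ℕ.* q) * (k * Q)   ≡⟨ cong (_* (k * Q)) (pos-* j q) ⟩
        (+ j * Q) * (k * Q)     ≡⟨ e (+ j) k Q ⟩
        (+ j * k) * (Q * Q)     ∎
        where open ≡-Reasoning
              e : ∀ j k q → (j * q) * (k * q) ≡ (j * k) * (q * q)
              e = solve-∀

      QQ∣G-[q+T*d] : Q * Q ∣ G q - (Q + T * d)
      QQ∣G-[q+T*d] = ∣-trans (∣-trans (*-monoˡ-∣ Q (divides k d≡k*Q)) (*-monoʳ-∣ d (divides k d≡k*Q)))
        (subst (λ g → d * d ∣ g - (Q + T * d)) (sym (G≡geometricSum[1+d] q))
               (d²∣geometricSum[1+d]-[n+triangle*d] d q))

      QQ∣Q : Q * Q ∣ Q
      QQ∣Q = subst (Q * Q ∣_) (e (G q) Q (T * d))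
        (∣m∣n⇒∣m-n (∣ᵤ⇒∣ {Q * Q} {G q} q²∣cofactor)
                   (∣m∣n⇒∣m+n QQ∣G-[q+T*d] (divides (+ j * k) T*d≡[j*k]*QQ)))
        where e : ∀ g q t → g - ((g - (q + t)) + t) ≡ q
              e = solve-∀

      q<q*q : q ℕ.< q ℕ.* q
      q<q*q = ℕ.m<m*n q q ⦃ prime⇒nonZero pq ⦄ (prime⇒1< pq)

open import Defs
open import Data.Nat
open import Data.Nat.Properties
open import Data.Nat.Divisibility
open import Data.Nat.Primality
open import Data.Nat.GCD using (gcd; gcd[m,n]∣m; gcd[m,n]∣n)
open import Data.Nat.Tactic.RingSolver using (solve-∀)
open import Data.Product using (∃-syntax; _×_; _,_)
open import Data.Sum using (_⊎_; inj₁; inj₂)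
open import Data.Empty using (⊥-elim)
open import Relation.Nullary using (¬_; Dec; yes; no)
open import Relation.Binary.PropositionalEquality
open ElementaryFacts
open Congruences using (_^_≡1[mod_]; ^≡1-*; ^≡1-gcd; fermat-^≡1; ∣^+1⇒^[2*]≡1;
  ^[2*]≡1⇒^≡1⊎∣^+1; ^≡1∧∣^+1⇒∣2; cofactor; [x+1]*cofactor; ∣x+1∧∣cofactor⇒∣n; q²∤cofactor)

n<cofactor : ∀ {x n} → 3 ≤ x → 2 ≤ n → ¬ 2 ∣ n → n < cofactor x n
n<cofactor {x} {n@(suc (suc k))} 3≤x (s≤s (s≤s _)) n-odd = *-cancelˡ-< (x + 1) n (cofactor x n) (begin-strict
  (x + 1) * n          ≤⟨ [x+1]*[2+k]≤x^[2+k] k 3≤x ⟩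
  x ^ n                <⟨ m<m+n (x ^ n) (s≤s z≤n) ⟩
  x ^ n + 1            ≡⟨ sym ([x+1]*cofactor x n-odd) ⟩
  (x + 1) * cofactor x n ∎)
  where open ≤-Reasoning

x+1∣x^n+1 : ∀ {x n} → ¬ 2 ∣ n → x + 1 ∣ x ^ n + 1
x+1∣x^n+1 {x} {n} n-odd =
  divides (cofactor x n) (trans (sym ([x+1]*cofactor x n-odd)) (*-comm (x + 1) (cofactor x n)))

x^r+1≢2^a*q^b : ∀ {x r q} a b → 3 ≤ x → ¬ 2 ∣ x → Prime r → ¬ 2 ∣ r → Prime q → q ∣ x + 1 →
                x ^ r + 1 ≢ 2 ^ a * q ^ b
x^r+1≢2^a*q^b {x} {r} {q} a b 3≤x x-odd pr r-odd pq q∣x+1 x^r+1≡2^a*q^b =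
  s≢q^c (∣p^n⇒≡p^m b pq (coprime-∣^* a (prime∤⇒coprime prime[2] s-odd) s∣2^a*q^b))
  where
  s = cofactor x r
  r<s : r < s
  r<s = n<cofactor 3≤x (prime⇒1< pr) r-odd
  s∣2^a*q^b : s ∣ 2 ^ a * q ^ b
  s∣2^a*q^b = divides (x + 1) (trans (sym x^r+1≡2^a*q^b) (sym ([x+1]*cofactor x r-odd)))
  s-odd : ¬ 2 ∣ s
  s-odd 2∣s = r-odd (∣x+1∧∣cofactor⇒∣n (odd⇒2∣n+1 x-odd) 2∣s)
  q∣s⇒q≡r : q ∣ s → q ≡ r
  q∣s⇒q≡r q∣s = prime∣prime⇒≡ pq pr (∣x+1∧∣cofactor⇒∣n q∣x+1 q∣s)
  s≢q^c : ¬ (∃[ c ] s ≡ q ^ c)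
  s≢q^c (zero , s≡1) = <-asym (subst (r <_) s≡1 r<s) (prime⇒1< pr)
  s≢q^c (1 , s≡q*1) = <-irrefl (sym (trans s≡q (q∣s⇒q≡r (∣-reflexive (sym s≡q))))) r<s
    where s≡q = trans s≡q*1 (*-identityʳ q)
  s≢q^c (suc (suc c) , s≡q^[2+c]) =
    q²∤cofactor pq q-odd q∣x+1 (subst (λ n → q * q ∣ cofactor x n) (sym q≡r) q²∣s)
    where
    q²∣s : q * q ∣ s
    q²∣s = divides (q ^ c) (trans s≡q^[2+c] (trans (sym (*-assoc q q (q ^ c))) (*-comm (q * q) (q ^ c))))
    q≡r : q ≡ r
    q≡r = q∣s⇒q≡r (∣-trans (m∣m*n q) q²∣s)
    q-odd : ¬ 2 ∣ q
    q-odd = subst (λ n → ¬ 2 ∣ n) (sym q≡r) r-odd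

q∤p^d+1 : ∀ {p q r e d a b} → Prime p → ¬ 2 ∣ p → Prime r → ¬ 2 ∣ r → Prime q → 1 ≤ e → e ≡ d * r →
          p ^ e + 1 ≡ 2 ^ a * q ^ b → ¬ q ∣ p ^ d + 1
q∤p^d+1 {d = zero} _ _ _ _ _ 1≤e e≡0 = ⊥-elim (<⇒≢ 1≤e (sym e≡0))
q∤p^d+1 {p} {q} {r} {e} {d@(suc _)} {a} {b} pp p-odd pr r-odd pq _ e≡d*r p^e+1≡2^a*q^b q∣p^d+1 =
  x^r+1≢2^a*q^b a b 3≤p^d (odd-^ d p-odd) pr r-odd pq q∣p^d+1 p^d^r+1≡2^a*q^b
  where
  3≤p^d : 3 ≤ p ^ d
  3≤p^d = ≤-trans (odd-prime⇒3≤ pp p-odd) (x≤x^n {n = d} (prime⇒1≤ pp) (s≤s z≤n))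
  p^d^r+1≡2^a*q^b : (p ^ d) ^ r + 1 ≡ 2 ^ a * q ^ b
  p^d^r+1≡2^a*q^b =
    trans (cong (λ n → n + 1) (trans (^-*-assoc p d r) (cong (p ^_) (sym e≡d*r)))) p^e+1≡2^a*q^b

p^e+1≢2^a : ∀ {p e} a → Prime p → ¬ 2 ∣ p → 2 ≤ e → p ^ e + 1 ≢ 2 ^ a
p^e+1≢2^a {p} {e} a pp p-odd 2≤e p^e+1≡2^a with 2 ∣? e
... | yes (divides zero e≡0) = <⇒≢ (<⇒≤ 2≤e) (sym e≡0)
... | yes (divides f@(suc _) e≡f*2) =
  odd^2+1≢2^a a 3≤p^f (odd-^ f p-odd) (trans (cong (λ n → n + 1) p^f^2≡p^e) p^e+1≡2^a)
  where
  3≤p^f : 3 ≤ p ^ f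
  3≤p^f = ≤-trans (odd-prime⇒3≤ pp p-odd) (x≤x^n {n = f} (prime⇒1≤ pp) (s≤s z≤n))
  p^f^2≡p^e : (p ^ f) ^ 2 ≡ p ^ e
  p^f^2≡p^e = trans (^-*-assoc p f 2) (cong (p ^_) (sym e≡f*2))
... | no e-odd with odd⇒∃oddPrime-factor 2≤e e-odd
...   | d , r , pr , r-odd , e≡d*r =
  q∤p^d+1 {d = d} {a} {0} pp p-odd pr r-odd prime[2] (<⇒≤ 2≤e) e≡d*r
    (trans p^e+1≡2^a (sym (*-identityʳ (2 ^ a))))
    (odd⇒2∣n+1 (odd-^ d p-odd))

mersennePrime : ∀ {p} → Prime p → ∃[ m ] p + 1 ≡ 2 ^ m → MersennePrime p
mersennePrime {p} pp (zero , p+1≡1) = ⊥-elim (¬prime[0] (subst Prime (+-cancelʳ-≡ 1 p 0 p+1≡1) pp))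
mersennePrime {p} pp (m@(suc _) , p+1≡2^m) =
  pp , m , s≤s z≤n , sym (trans (cong (_∸ 1) (sym p+1≡2^m)) (m+n∸n≡m p 1))

module PrimeDivisorOfPowerPlusOne {p q e a b : ℕ}
         (pp : Prime p) (p-odd : ¬ 2 ∣ p) (pq : Prime q) (q-odd : ¬ 2 ∣ q) (2≤e : 2 ≤ e)
         (p^e+1≡2^a*q^b : p ^ e + 1 ≡ 2 ^ a * q ^ b) (q∣p^e+1 : q ∣ p ^ e + 1) where

  private
    q∤p^d+1′ : ∀ {d r} → Prime r → ¬ 2 ∣ r → e ≡ d * r → ¬ q ∣ p ^ d + 1
    q∤p^d+1′ {d} pr r-odd e≡d*r =
      q∤p^d+1 {d = d} {a} {b} pp p-odd pr r-odd pq (<⇒≤ 2≤e) e≡d*r p^e+1≡2^a*q^b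

    ¬p^e≡1 : ¬ p ^ e ≡1[mod q ]
    ¬p^e≡1 p^e≡1 = <⇒≱ (odd-prime⇒3≤ pq q-odd) (∣⇒≤ (^≡1∧∣^+1⇒∣2 {q} {p} {e} p^e≡1 q∣p^e+1))

    ¬p^2d≡1 : ∀ {d r} → Prime r → ¬ 2 ∣ r → e ≡ d * r → ¬ p ^ (2 * d) ≡1[mod q ]
    ¬p^2d≡1 {d} {r} pr r-odd e≡d*r p^2d≡1 with ^[2*]≡1⇒^≡1⊎∣^+1 {q} {p} {d} pq p^2d≡1
    ... | inj₁ p^d≡1 =
      ¬p^e≡1 (subst (p ^_≡1[mod q ]) (sym (trans e≡d*r (*-comm d r))) (^≡1-* {n = d} r p^d≡1))
    ... | inj₂ q∣p^d+1 = q∤p^d+1′ {d} pr r-odd e≡d*r q∣p^d+1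

    ¬p^m≡1 : ∀ {r m} → Prime r → 2 * e ≡ r * m → ¬ p ^ m ≡1[mod q ]
    ¬p^m≡1 {r} {m} pr 2e≡r*m p^m≡1 with 2 ∣? r
    ... | yes 2∣r = ¬p^e≡1 (subst (p ^_≡1[mod q ]) m≡e p^m≡1)
      where
      m≡e : m ≡ e
      m≡e = *-cancelˡ-≡ m e 2 (trans (cong (_* m) (prime∣prime⇒≡ prime[2] pr 2∣r)) (sym 2e≡r*m))
    ... | no r-odd with euclidsLemma 2 e pr (divides m (trans 2e≡r*m (*-comm r m)))
    ...   | inj₁ r∣2 = r-odd (subst (2 ∣_) (sym (prime∣prime⇒≡ pr prime[2] r∣2)) (∣-refl {2}))
    ...   | inj₂ (divides d e≡d*r) = ¬p^2d≡1 {d} pr r-odd e≡d*r (subst (p ^_≡1[mod q ]) m≡2*d p^m≡1)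
      where
      m≡2*d : m ≡ 2 * d
      m≡2*d = *-cancelˡ-≡ m (2 * d) r ⦃ prime⇒nonZero pr ⦄
        (trans (sym 2e≡r*m) (trans (cong (2 *_) e≡d*r) (rearrange d r)))
        where rearrange : ∀ d r → 2 * (d * r) ≡ r * (2 * d)
              rearrange = solve-∀

    q∤p : ¬ q ∣ p
    q∤p q∣p =
      ¬prime[1] (subst Prime (∣1⇒≡1 (∣m+n∣m⇒∣n q∣p^e+1 (∣-trans q∣p (m∣m^n (<⇒≤ 2≤e))))) pq)

    -- g = gcd (2e) (q - 1) is a period of p modulo q, and no 2e / r with r prime is one.
    2e∣q-1 : 2 * e ∣ q ∸ 1
    2e∣q-1 = subst (_∣ q ∸ 1) g≡2e (gcd[m,n]∣n (2 * e) (q ∸ 1))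
      where
      g = gcd (2 * e) (q ∸ 1)
      p^g≡1 : p ^ g ≡1[mod q ]
      p^g≡1 = ^≡1-gcd {q} {p} {2 * e} {q ∸ 1} (∣^+1⇒^[2*]≡1 {q} {p} {e} q∣p^e+1) (fermat-^≡1 pq q∤p)
      g≡2e : g ≡ 2 * e
      g≡2e = ∣-maximal⇒≡ ⦃ m*n≢0 2 e ⦃ _ ⦄ ⦃ >-nonZero (<⇒≤ 2≤e) ⦄ ⦄ (gcd[m,n]∣m (2 * e) (q ∸ 1))
        (λ {r} {m} pr 2e≡r*m (divides c m≡c*g) →
          ¬p^m≡1 pr 2e≡r*m (subst (p ^_≡1[mod q ]) (sym m≡c*g) (^≡1-* {n = g} c p^g≡1)))

  q≡1[mod2e] : q ≡ 1 [mod 2 * e ]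
  q≡1[mod2e] = prime⇒1≤ pq , 2e∣q-1

  mersenne : ¬ 2 ∣ e → MersennePrime p
  mersenne e-odd = mersennePrime pp (∣p^n⇒≡p^m a prime[2] p+1∣2^a)
    where
    q∤p+1 : ¬ q ∣ p + 1
    q∤p+1 q∣p+1 with odd⇒∃oddPrime-factor 2≤e e-odd
    ... | d , r , pr , r-odd , e≡d*r = q∤p^d+1′ {d} pr r-odd e≡d*r (∣-trans q∣p+1 (x+1∣x^n+1 d-odd))
      where d-odd : ¬ 2 ∣ d
            d-odd 2∣d = e-odd (subst (2 ∣_) (sym e≡d*r) (∣m⇒∣m*n r 2∣d))
    p+1∣2^a : p + 1 ∣ 2 ^ a
    p+1∣2^a = coprime-∣^* b (prime∤⇒coprime pq q∤p+1)
      (subst (p + 1 ∣_) (trans p^e+1≡2^a*q^b (*-comm (2 ^ a) (q ^ b))) (x+1∣x^n+1 e-odd))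

lemma2p2 : (p q e a b : ℕ) → Prime p → ¬ (2 ∣ p) → Prime q → ¬ (2 ∣ q) → 1 ≤ e →
    p ^ e + 1 ≡ 2 ^ a * q ^ b →
    (e ≡ 1) ⊎ ((2 ∣ e) × (q ≡ 1 [mod 2 * e ])) ⊎ (MersennePrime p × (q ≡ 1 [mod 2 * e ]))
lemma2p2 p q 1 a b _ _ _ _ _ _ = inj₁ refl
lemma2p2 p q e@(suc (suc _)) a zero pp p-odd _ _ _ p^e+1≡2^a*1 =
  ⊥-elim (p^e+1≢2^a {p} {e} a pp p-odd (s≤s (s≤s z≤n)) (trans p^e+1≡2^a*1 (*-identityʳ (2 ^ a))))
lemma2p2 p q e@(suc (suc _)) a b@(suc b′) pp p-odd pq q-odd _ p^e+1≡2^a*q^b = inj₂ (by-parity (2 ∣? e))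
  where
  open PrimeDivisorOfPowerPlusOne {p} {q} {e} {a} {b} pp p-odd pq q-odd (s≤s (s≤s z≤n)) p^e+1≡2^a*q^b
    (subst (q ∣_) (sym p^e+1≡2^a*q^b) (∣n⇒∣m*n (2 ^ a) (m∣m*n (q ^ b′))))
  by-parity : Dec (2 ∣ e) → (2 ∣ e × q ≡ 1 [mod 2 * e ]) ⊎ (MersennePrime p × q ≡ 1 [mod 2 * e ])
  by-parity (yes 2∣e) = inj₁ (2∣e , q≡1[mod2e])
  by-parity (no e-odd) = inj₂ (mersenne e-odd , q≡1[mod2e])
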